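{- Let $m\ge2$ be an integer. The following are equivalent: (i) there exists the incidence matrix $A$ of a symmetric group divisible design with parameters $(2m,m,m,2,0,\frac{m}{2})$ satisfying $A(I_m\otimes J_2)=(I_m\otimes J_2)A=J_{2m}$; (ii) there exists a Hadamard matrix of order $m$.
   Context: $I_n,J_n$ denote the identity and all-ones matrices of order $n$, and $\otimes$ is the Kronecker product. A $v\times v$ $(0,1)$-matrix $A$ ($v=mn$) is the incidence matrix of a symmetric group divisible design with parameters $(v,k,m,n,\lambda_1,\lambda_2)$ if $AA^\top=A^\top A=kI_v+\lambda_1(I_m\otimes J_n-I_v)+\lambda_2(J_v-I_m\otimes J_n)$. A Hadamard matrix of order $m$ is an $m\times m$ matrix $H$ with entries $\pm1$ and $HH^\top=mI_m$. -}

module Defs where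

open import Data.Nat using (ℕ; zero; suc)
import Data.Nat as ℕ
open import Data.Fin using (Fin; zero; suc; quotient; remainder; _≟_)
open import Data.Integer using (ℤ; +_; -_; _+_; _*_; -1ℤ; 1ℤ; 0ℤ)
open import Data.Product using (_×_; _,_)
open import Data.Sum using (_⊎_)
open import Relation.Nullary.Decidable using (does)
open import Data.Bool using (if_then_else_)
open import Relation.Binary.PropositionalEquality using (_≡_)

Matrix : ℕ → ℕ → Set
Matrix r c = Fin r → Fin c → ℤ

Σ : ∀ {n} → (Fin n → ℤ) → ℤ
Σ {zero}  f = 0ℤ
Σ {suc n} f = f zero + Σ (λ i → f (suc i))

_⊗ₘ_ : ∀ {a b c d} → Matrix a b → Matrix c d → Matrix (a ℕ.* c) (b ℕ.* d)
(_⊗ₘ_ {a} {b} {c} {d} A B) i j =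
  A (quotient {a} c i) (quotient {b} d j) * B (remainder {a} c i) (remainder {b} d j)

_·_ : ∀ {a b c} → Matrix a b → Matrix b c → Matrix a c
(A · B) i k = Σ (λ j → A i j * B j k)

_ᵀ : ∀ {a b} → Matrix a b → Matrix b a
(A ᵀ) i j = A j i

_+ₘ_ : ∀ {a b} → Matrix a b → Matrix a b → Matrix a b
(A +ₘ B) i j = A i j + B i j

_-ₘ_ : ∀ {a b} → Matrix a b → Matrix a b → Matrix a b
(A -ₘ B) i j = A i j + - B i j

_∙ₘ_ : ∀ {a b} → ℤ → Matrix a b → Matrix a b
(x ∙ₘ A) i j = x * A i j

I : ∀ n → Matrix n n
I n i j = if does (i ≟ j) then 1ℤ else 0ℤ

J : ∀ r c → Matrix r c
J r c i j = 1ℤ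

_≐_ : ∀ {a b} → Matrix a b → Matrix a b → Set
A ≐ B = ∀ i j → A i j ≡ B i j

IsZeroOne : ∀ {a b} → Matrix a b → Set
IsZeroOne A = ∀ i j → (A i j ≡ 0ℤ) ⊎ (A i j ≡ 1ℤ)

IsPlusMinusOne : ∀ {a b} → Matrix a b → Set
IsPlusMinusOne A = ∀ i j → (A i j ≡ 1ℤ) ⊎ (A i j ≡ -1ℤ)

IsHadamard : ∀ m → Matrix m m → Set
IsHadamard m H = IsPlusMinusOne H × ((H · (H ᵀ)) ≐ ((+ m) ∙ₘ I m))

GDDGram : ∀ m n → (k λ₁ λ₂ : ℤ) → Matrix (m ℕ.* n) (m ℕ.* n)
GDDGram m n k λ₁ λ₂ =
  ((k ∙ₘ I v) +ₘ (λ₁ ∙ₘ ((I m ⊗ₘ J n n) -ₘ I v)))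
    +ₘ (λ₂ ∙ₘ (J v v -ₘ (I m ⊗ₘ J n n)))
  where v = m ℕ.* n

IsSGDD : ∀ m n → (k λ₁ λ₂ : ℤ) → Matrix (m ℕ.* n) (m ℕ.* n) → Set
IsSGDD m n k λ₁ λ₂ A =
  IsZeroOne A × ((A · (A ᵀ)) ≐ GDDGram m n k λ₁ λ₂)
              × (((A ᵀ) · A) ≐ GDDGram m n k λ₁ λ₂)

-- Variant with λ₂ = μ/2 given by its double: 2·AAᵀ = 2·(Gram), with the
-- λ₂-term entering as μ (J − I⊗J). Used for λ₂ = m/2 which may be non-integral.
GDDGram2 : ∀ m n → (k λ₁ μ : ℤ) → Matrix (m ℕ.* n) (m ℕ.* n)
GDDGram2 m n k λ₁ μ =
  (((+ 2) * k) ∙ₘ I v) +ₘ ((((+ 2) * λ₁) ∙ₘ ((I m ⊗ₘ J n n) -ₘ I v))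
    +ₘ (μ ∙ₘ (J v v -ₘ (I m ⊗ₘ J n n))))
  where v = m ℕ.* n

IsSGDDHalf : ∀ m n → (k λ₁ μ : ℤ) → Matrix (m ℕ.* n) (m ℕ.* n) → Set
IsSGDDHalf m n k λ₁ μ A =
  IsZeroOne A × (((+ 2) ∙ₘ (A · (A ᵀ))) ≐ GDDGram2 m n k λ₁ μ)
              × (((+ 2) ∙ₘ ((A ᵀ) · A)) ≐ GDDGram2 m n k λ₁ μ)

-- Index the 2m points as pairs (i, s) with i < m and s < 2, so that I_m ⊗ J_2 groups them in pairs.
-- The conditions A(I ⊗ J) = (I ⊗ J)A = J say that every 2×2 block of A has unit row and column
-- sums, so, being a (0,1)-block, it is I₂ or J₂ − I₂: A arises from a ±1 matrix H by replacing 1 with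
-- I₂ and −1 with J₂ − I₂. For such A, 2(AAᵀ) at the points (i,r), (k,t) equals m + sign_rt (HHᵀ)_ik
-- with sign = 2I₂ − J₂, so the design equation for AAᵀ is exactly HHᵀ = mI, and the one for AᵀA is
-- HᵀH = mI, which follows from HHᵀ = mI by a trace argument.

module Submission where

open import Defs
open import Data.Nat as ℕ using (ℕ; zero; suc)
open import Data.Nat.Properties using (m+n≡0⇒m≡0; m+n≡0⇒n≡0)
open import Data.Fin using (Fin; zero; suc; combine; quotient; remainder; _↑ˡ_; _↑ʳ_; _≟_)
open import Data.Fin.Properties using (remQuot-combine; combine-remQuot)
open import Data.Integer using (ℤ; +_; +[1+_]; -[1+_]; -_; _+_; _-_; _*_; _≤_; +≤+; 0ℤ; 1ℤ; -1ℤ)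
open import Data.Integer.Properties
  using ( +-*-semiring; +-0-abelianGroup; +-assoc; +-comm; +-identityˡ; +-identityʳ; +-inverseʳ; +-injective
        ; +-mono-≤; ≤-refl; *-comm; *-identityˡ; *-identityʳ; *-zeroʳ; *-cancelˡ-≡; -1*i≡-i
        ; i-j≡0⇒i≡j; i*j≡0⇒i≡0∨j≡0 )
open import Data.Integer.Tactic.RingSolver using (solve-∀)
open import Algebra.Properties.Semiring.Sum +-*-semiring
  using (sum; sum-cong-≗; ∑-distrib-+; ∑-comm; *-distribˡ-sum; *-distribʳ-sum; sum-replicate-zero)
open import Algebra.Properties.AbelianGroup +-0-abelianGroup using (∙-cancelˡ)
open import Data.Fin.Patterns using (0F; 1F)
open import Data.Product using (Σ-syntax; _×_; _,_; proj₁; proj₂)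
open import Data.Sum using (_⊎_; inj₁; inj₂; [_,_]′)
open import Function using (id; _∘_)
open import Function.Bundles using (_⇔_; mk⇔)
open import Relation.Nullary using (Dec; yes; no)
open import Relation.Nullary.Decidable using (dec-true; dec-false)
open import Relation.Binary.PropositionalEquality
  using (_≡_; _≢_; refl; sym; trans; cong; cong₂; module ≡-Reasoning)
open ≡-Reasoning

Σ≡sum : ∀ {n} (f : Fin n → ℤ) → Σ f ≡ sum f
Σ≡sum {zero}  f = refl
Σ≡sum {suc n} f = cong (_+_ (f zero)) (Σ≡sum (f ∘ suc))

Σ-cong : ∀ {n} {f g : Fin n → ℤ} → (∀ i → f i ≡ g i) → Σ f ≡ Σ g
Σ-cong {f = f} {g} f≗g = trans (Σ≡sum f) (trans (sum-cong-≗ {x = f} {g} f≗g) (sym (Σ≡sum g)))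

Σ-distrib-+ : ∀ {n} (f g : Fin n → ℤ) → Σ (λ i → f i + g i) ≡ Σ f + Σ g
Σ-distrib-+ f g = trans (Σ≡sum (λ i → f i + g i))
  (trans (∑-distrib-+ f g) (sym (cong₂ _+_ (Σ≡sum f) (Σ≡sum g))))

*-distribˡ-Σ : ∀ {n} a (f : Fin n → ℤ) → a * Σ f ≡ Σ (λ i → a * f i)
*-distribˡ-Σ a f = trans (cong (a *_) (Σ≡sum f)) (trans (*-distribˡ-sum a f) (sym (Σ≡sum (λ i → a * f i))))

*-distribʳ-Σ : ∀ {n} a (f : Fin n → ℤ) → Σ f * a ≡ Σ (λ i → f i * a)
*-distribʳ-Σ a f = trans (cong (_* a) (Σ≡sum f)) (trans (*-distribʳ-sum a f) (sym (Σ≡sum (λ i → f i * a))))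

Σ-comm : ∀ {m n} (f : Fin m → Fin n → ℤ) → Σ (λ i → Σ (f i)) ≡ Σ (λ j → Σ (λ i → f i j))
Σ-comm f = begin
  Σ (λ i → Σ (f i))            ≡⟨ Σ-cong (Σ≡sum ∘ f) ⟩
  Σ (λ i → sum (f i))          ≡⟨ Σ≡sum (λ i → sum (f i)) ⟩
  sum (λ i → sum (f i))        ≡⟨ ∑-comm f ⟩
  sum (λ j → sum (λ i → f i j)) ≡⟨ Σ≡sum (λ j → sum (λ i → f i j)) ⟨
  Σ (λ j → sum (λ i → f i j))  ≡⟨ Σ-cong (λ j → Σ≡sum (λ i → f i j)) ⟨
  Σ (λ j → Σ (λ i → f i j))    ∎

Σ-zero : ∀ n → Σ {n} (λ _ → 0ℤ) ≡ 0ℤ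
Σ-zero n = trans (Σ≡sum {n} (λ _ → 0ℤ)) (sum-replicate-zero n)

Σ-ones : ∀ n → Σ {n} (λ _ → 1ℤ) ≡ + n
Σ-ones zero    = refl
Σ-ones (suc n) = cong (_+_ 1ℤ) (Σ-ones n)

Σ-neg : ∀ {n} (f : Fin n → ℤ) → Σ (λ i → - f i) ≡ - Σ f
Σ-neg f = begin
  Σ (λ i → - f i)      ≡⟨ Σ-cong (λ i → -1*i≡-i (f i)) ⟨
  Σ (λ i → -1ℤ * f i)  ≡⟨ *-distribˡ-Σ -1ℤ f ⟨
  -1ℤ * Σ f            ≡⟨ -1*i≡-i (Σ f) ⟩
  - Σ f                ∎

Σ-distrib-- : ∀ {n} (f g : Fin n → ℤ) → Σ (λ i → f i - g i) ≡ Σ f - Σ g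
Σ-distrib-- f g = trans (Σ-distrib-+ f (λ i → - g i)) (cong (_+_ (Σ f)) (Σ-neg g))

Σ-linear : ∀ {n} (f g h : Fin n → ℤ) a b →
  Σ (λ i → f i + (a * g i + b * h i)) ≡ Σ f + (a * Σ g + b * Σ h)
Σ-linear f g h a b = begin
  Σ (λ i → f i + (a * g i + b * h i))
    ≡⟨ Σ-distrib-+ f _ ⟩
  Σ f + Σ (λ i → a * g i + b * h i)
    ≡⟨ cong (_+_ (Σ f)) (Σ-distrib-+ (λ i → a * g i) (λ i → b * h i)) ⟩
  Σ f + (Σ (λ i → a * g i) + Σ (λ i → b * h i))
    ≡⟨ cong (_+_ (Σ f)) (cong₂ _+_ (*-distribˡ-Σ a g) (*-distribˡ-Σ b h)) ⟨
  Σ f + (a * Σ g + b * Σ h) ∎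

Σ-product : ∀ {m n} (f : Fin m → ℤ) (g : Fin n → ℤ) → Σ f * Σ g ≡ Σ (λ i → Σ (λ j → f i * g j))
Σ-product f g = trans (*-distribʳ-Σ (Σ g) f) (Σ-cong (λ i → *-distribˡ-Σ (f i) g))

Σ-splitAt : ∀ m {n} (f : Fin (m ℕ.+ n) → ℤ) → Σ f ≡ Σ (λ i → f (i ↑ˡ n)) + Σ (λ j → f (m ↑ʳ j))
Σ-splitAt zero    f = sym (+-identityˡ (Σ f))
Σ-splitAt (suc m) f = trans (cong (_+_ (f zero)) (Σ-splitAt m (f ∘ suc))) (sym (+-assoc (f zero) _ _))

Σ-combine : ∀ m {n} (f : Fin (m ℕ.* n) → ℤ) → Σ f ≡ Σ {m} (λ i → Σ {n} (λ r → f (combine i r)))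
Σ-combine zero    f = refl
Σ-combine (suc m) {n} f =
  trans (Σ-splitAt n f) (cong (_+_ (Σ (λ r → f (r ↑ˡ m ℕ.* n)))) (Σ-combine m (f ∘ (n ↑ʳ_))))

Σ-Fin2 : (f : Fin 2 → ℤ) → Σ f ≡ f 0F + f 1F
Σ-Fin2 f = cong (_+_ (f 0F)) (+-identityʳ (f 1F))

Σ-pairs : ∀ m (f : Fin (m ℕ.* 2) → ℤ) → Σ f ≡ Σ {m} (λ j → f (combine j 0F) + f (combine j 1F))
Σ-pairs m f = trans (Σ-combine m f) (Σ-cong {m} (λ j → Σ-Fin2 (λ r → f (combine j r))))

Σ-nonneg : ∀ {n} {f : Fin n → ℤ} → (∀ i → 0ℤ ≤ f i) → 0ℤ ≤ Σ f
Σ-nonneg {zero}  _   = ≤-refl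
Σ-nonneg {suc n} f≥0 = +-mono-≤ (f≥0 zero) (Σ-nonneg (f≥0 ∘ suc))

nonneg+nonneg≡0 : ∀ {a b} → 0ℤ ≤ a → 0ℤ ≤ b → a + b ≡ 0ℤ → a ≡ 0ℤ × b ≡ 0ℤ
nonneg+nonneg≡0 (+≤+ {n = k} _) (+≤+ _) a+b≡0 =
  cong +_ (m+n≡0⇒m≡0 k (+-injective a+b≡0)) , cong +_ (m+n≡0⇒n≡0 k (+-injective a+b≡0))

Σ-nonneg-≡0 : ∀ {n} {f : Fin n → ℤ} → (∀ i → 0ℤ ≤ f i) → Σ f ≡ 0ℤ → ∀ i → f i ≡ 0ℤ
Σ-nonneg-≡0 {suc n} f≥0 Σf≡0 i with nonneg+nonneg≡0 (f≥0 zero) (Σ-nonneg (f≥0 ∘ suc)) Σf≡0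
Σ-nonneg-≡0 f≥0 _ zero    | f₀≡0 , _      = f₀≡0
Σ-nonneg-≡0 f≥0 _ (suc i) | _    , rest≡0 = Σ-nonneg-≡0 (f≥0 ∘ suc) rest≡0 i

square-nonneg : ∀ x → 0ℤ ≤ x * x
square-nonneg (+ zero)  = +≤+ ℕ.z≤n
square-nonneg +[1+ n ]  = +≤+ ℕ.z≤n
square-nonneg -[1+ n ]  = +≤+ ℕ.z≤n

I-refl : ∀ {n} (i : Fin n) → I n i i ≡ 1ℤ
I-refl i rewrite dec-true (i ≟ i) refl = refl

I-≢ : ∀ {n} {i j : Fin n} → i ≢ j → I n i j ≡ 0ℤ
I-≢ {i = i} {j} i≢j rewrite dec-false (i ≟ j) i≢j = refl

I-sym : ∀ {n} (i j : Fin n) → I n i j ≡ I n j i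
I-sym zero    zero    = refl
I-sym zero    (suc j) = refl
I-sym (suc i) zero    = refl
I-sym (suc i) (suc j) = I-sym i j

Σ-selectˡ : ∀ {n} (i : Fin n) (f : Fin n → ℤ) → Σ (λ j → I n i j * f j) ≡ f i
Σ-selectˡ {suc n} zero    f = begin
  1ℤ * f zero + Σ {n} (λ _ → 0ℤ) ≡⟨ cong₂ _+_ (*-identityˡ (f zero)) (Σ-zero n) ⟩
  f zero + 0ℤ                     ≡⟨ +-identityʳ (f zero) ⟩
  f zero                          ∎
Σ-selectˡ {suc n} (suc i) f =
  trans (+-identityˡ _) (Σ-selectˡ i (f ∘ suc))

Σ-selectʳ : ∀ {n} (i : Fin n) (f : Fin n → ℤ) → Σ (λ j → f j * I n j i) ≡ f i
Σ-selectʳ {n} i f =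
  trans (Σ-cong (λ j → trans (*-comm (f j) _) (cong (_* f j) (I-sym j i)))) (Σ-selectˡ i f)

·-cong : ∀ {a b c} {A A′ : Matrix a b} {B B′ : Matrix b c} → A ≐ A′ → B ≐ B′ → (A · B) ≐ (A′ · B′)
·-cong A≐A′ B≐B′ i k = Σ-cong (λ j → cong₂ _*_ (A≐A′ i j) (B≐B′ j k))

module _ {m n : ℕ} where

  quotient-combine : ∀ (i : Fin m) (r : Fin n) → quotient {m} n (combine i r) ≡ i
  quotient-combine i r = cong proj₁ (remQuot-combine i r)

  remainder-combine : ∀ (i : Fin m) (r : Fin n) → remainder {m} n (combine i r) ≡ r
  remainder-combine i r = cong proj₂ (remQuot-combine i r)

  quotient-remainder-injective : ∀ {x y : Fin (m ℕ.* n)} →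
    quotient {m} n x ≡ quotient {m} n y → remainder {m} n x ≡ remainder {m} n y → x ≡ y
  quotient-remainder-injective {x} {y} q≡ r≡ = begin
    x                                                ≡⟨ combine-remQuot {m} n x ⟨
    combine (quotient {m} n x) (remainder {m} n x)   ≡⟨ cong₂ combine q≡ r≡ ⟩
    combine (quotient {m} n y) (remainder {m} n y)   ≡⟨ combine-remQuot {m} n y ⟩
    y                                                ∎

  I⊗I≐I : (I m ⊗ₘ I n) ≐ I (m ℕ.* n)
  I⊗I≐I x y = by-cases (x ≟ y)
    where
    qₓ q_y : Fin m
    qₓ = quotient {m} n x
    q_y = quotient {m} n y
    rₓ r_y : Fin n
    rₓ = remainder {m} n x
    r_y = remainder {m} n y
    by-cases : Dec (x ≡ y) → I m qₓ q_y * I n rₓ r_y ≡ I (m ℕ.* n) x y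
    by-cases (yes refl) = trans (cong₂ _*_ (I-refl qₓ) (I-refl rₓ)) (sym (I-refl x))
    by-cases (no x≢y) = trans (off-diagonal (qₓ ≟ q_y)) (sym (I-≢ x≢y))
      where
      off-diagonal : Dec (qₓ ≡ q_y) → I m qₓ q_y * I n rₓ r_y ≡ 0ℤ
      off-diagonal (no q≢) = cong (_* I n rₓ r_y) (I-≢ q≢)
      off-diagonal (yes q≡) =
        trans (cong (I m qₓ q_y *_) (I-≢ (x≢y ∘ quotient-remainder-injective q≡))) (*-zeroʳ (I m qₓ q_y))

  ·-I⊗J : ∀ {a} (X : Matrix a (m ℕ.* n)) x y →
    (X · (I m ⊗ₘ J n n)) x y ≡ Σ {n} (λ r → X x (combine (quotient {m} n y) r))
  ·-I⊗J X x y = begin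
    Σ (λ z → X x z * (I m (quotient {m} n z) (quotient {m} n y) * 1ℤ))
      ≡⟨ Σ-combine m {n} _ ⟩
    Σ {m} (λ i → Σ {n} (λ r → X x (combine i r) * (I m (quotient {m} n (combine i r)) (quotient {m} n y) * 1ℤ)))
      ≡⟨ Σ-cong (λ i → Σ-cong (λ r → cong (X x (combine i r) *_)
           (trans (*-identityʳ _) (cong (λ k → I m k (quotient {m} n y)) (quotient-combine i r))))) ⟩
    Σ {m} (λ i → Σ {n} (λ r → X x (combine i r) * I m i (quotient {m} n y)))
      ≡⟨ Σ-cong (λ i → *-distribʳ-Σ (I m i (quotient {m} n y)) (λ r → X x (combine i r))) ⟨
    Σ {m} (λ i → Σ {n} (λ r → X x (combine i r)) * I m i (quotient {m} n y))
      ≡⟨ Σ-selectʳ (quotient {m} n y) (λ i → Σ {n} (λ r → X x (combine i r))) ⟩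
    Σ {n} (λ r → X x (combine (quotient {m} n y) r)) ∎

  I⊗J-· : ∀ {b} (X : Matrix (m ℕ.* n) b) x y →
    ((I m ⊗ₘ J n n) · X) x y ≡ Σ {n} (λ r → X (combine (quotient {m} n x) r) y)
  I⊗J-· X x y = trans
    (Σ-cong (λ z → trans (*-comm (I m (quotient {m} n x) (quotient {m} n z) * 1ℤ) (X z y))
                         (cong (λ d → X z y * (d * 1ℤ)) (I-sym (quotient {m} n x) (quotient {m} n z)))))
    (·-I⊗J (X ᵀ) y x)

‖_‖² : ∀ {a b} → Matrix a b → ℤ
‖ X ‖² = Σ (λ i → Σ (λ j → X i j * X i j))

tr : ∀ {n} → Matrix n n → ℤ
tr X = Σ (λ i → X i i)

‖‖²≡0⇒≐0 : ∀ {a b} (X : Matrix a b) → ‖ X ‖² ≡ 0ℤ → ∀ i j → X i j ≡ 0ℤ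
‖‖²≡0⇒≐0 X ‖X‖²≡0 i j = [ id , id ]′ (i*j≡0⇒i≡0∨j≡0 (X i j) Xᵢⱼ²≡0)
  where
  rowᵢ≡0 : Σ (λ j → X i j * X i j) ≡ 0ℤ
  rowᵢ≡0 = Σ-nonneg-≡0 (λ i → Σ-nonneg (λ j → square-nonneg (X i j))) ‖X‖²≡0 i
  Xᵢⱼ²≡0 : X i j * X i j ≡ 0ℤ
  Xᵢⱼ²≡0 = Σ-nonneg-≡0 (λ j → square-nonneg (X i j)) rowᵢ≡0 j

‖‖²-≐0 : ∀ {a b} (X : Matrix a b) → (∀ i j → X i j ≡ 0ℤ) → ‖ X ‖² ≡ 0ℤ
‖‖²-≐0 {a} {b} X X≐0 =
  trans (Σ-cong (λ i → trans (Σ-cong (λ j → cong (λ x → x * x) (X≐0 i j))) (Σ-zero b))) (Σ-zero a)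

ΣΣ-comm : ∀ {a b c d} (F : Fin a → Fin b → Fin c → Fin d → ℤ) →
  Σ (λ i → Σ (λ j → Σ (λ k → Σ (F i j k)))) ≡ Σ (λ k → Σ (λ l → Σ (λ i → Σ (λ j → F i j k l))))
ΣΣ-comm F = begin
  Σ (λ i → Σ (λ j → Σ (λ k → Σ (F i j k))))
    ≡⟨ Σ-cong (λ i → Σ-comm (λ j k → Σ (F i j k))) ⟩
  Σ (λ i → Σ (λ k → Σ (λ j → Σ (F i j k))))
    ≡⟨ Σ-cong (λ i → Σ-cong (λ k → Σ-comm (λ j l → F i j k l))) ⟩
  Σ (λ i → Σ (λ k → Σ (λ l → Σ (λ j → F i j k l))))
    ≡⟨ Σ-comm (λ i k → Σ (λ l → Σ (λ j → F i j k l))) ⟩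
  Σ (λ k → Σ (λ i → Σ (λ l → Σ (λ j → F i j k l))))
    ≡⟨ Σ-cong (λ k → Σ-comm (λ i l → Σ (λ j → F i j k l))) ⟩
  Σ (λ k → Σ (λ l → Σ (λ i → Σ (λ j → F i j k l)))) ∎

‖ᵀ·‖² : ∀ {a b} (X : Matrix a b) → ‖ (X ᵀ) · X ‖² ≡ ‖ X · (X ᵀ) ‖²
‖ᵀ·‖² X = begin
  Σ (λ i → Σ (λ j → Σ (λ k → X k i * X k j) * Σ (λ l → X l i * X l j)))
    ≡⟨ Σ-cong (λ i → Σ-cong (λ j → Σ-product (λ k → X k i * X k j) (λ l → X l i * X l j))) ⟩
  Σ (λ i → Σ (λ j → Σ (λ k → Σ (λ l → (X k i * X k j) * (X l i * X l j)))))
    ≡⟨ ΣΣ-comm (λ i j k l → (X k i * X k j) * (X l i * X l j)) ⟩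
  Σ (λ k → Σ (λ l → Σ (λ i → Σ (λ j → (X k i * X k j) * (X l i * X l j)))))
    ≡⟨ Σ-cong (λ k → Σ-cong (λ l → Σ-cong (λ i → Σ-cong (λ j → regroup (X k i) (X k j) (X l i) (X l j))))) ⟩
  Σ (λ k → Σ (λ l → Σ (λ i → Σ (λ j → (X k i * X l i) * (X k j * X l j)))))
    ≡⟨ Σ-cong (λ k → Σ-cong (λ l → Σ-product (λ i → X k i * X l i) (λ j → X k j * X l j))) ⟨
  Σ (λ k → Σ (λ l → Σ (λ i → X k i * X l i) * Σ (λ j → X k j * X l j))) ∎
  where
  regroup : ∀ a b c d → (a * b) * (c * d) ≡ (a * c) * (b * d)
  regroup = solve-∀

tr-ᵀ· : ∀ {a b} (X : Matrix a b) → tr ((X ᵀ) · X) ≡ tr (X · (X ᵀ))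
tr-ᵀ· X = Σ-comm (λ i k → X k i * X k i)

‖-ₘcI‖² : ∀ {n} (G : Matrix n n) c →
  ‖ G -ₘ (c ∙ₘ I n) ‖² ≡ ‖ G ‖² + (- (+ 2 * c) * tr G + (c * c) * tr (I n))
‖-ₘcI‖² {n} G c = begin
  ‖ G -ₘ (c ∙ₘ I n) ‖²
    ≡⟨ Σ-cong (λ i → Σ-cong (λ j → expand (G i j) (I n i j) c)) ⟩
  Σ (λ i → Σ (λ j → G i j * G i j + (α * (I n i j * G i j) + β * (I n i j * I n i j))))
    ≡⟨ Σ-cong (λ i → Σ-linear (λ j → G i j * G i j) (λ j → I n i j * G i j) (λ j → I n i j * I n i j) α β) ⟩
  Σ (λ i → Σ (λ j → G i j * G i j) + (α * Σ (λ j → I n i j * G i j) + β * Σ (λ j → I n i j * I n i j)))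
    ≡⟨ Σ-cong (λ i → cong₂ (λ u v → Σ (λ j → G i j * G i j) + (α * u + β * v))
         (Σ-selectˡ i (G i)) (Σ-selectˡ i (I n i))) ⟩
  Σ (λ i → Σ (λ j → G i j * G i j) + (α * G i i + β * I n i i))
    ≡⟨ Σ-linear (λ i → Σ (λ j → G i j * G i j)) (λ i → G i i) (λ i → I n i i) α β ⟩
  ‖ G ‖² + (α * tr G + β * tr (I n)) ∎
  where
  α β : ℤ
  α = - (+ 2 * c)
  β = c * c
  expand : ∀ g d c → (g - c * d) * (g - c * d) ≡ g * g + (- (+ 2 * c) * (d * g) + (c * c) * (d * d))
  expand = solve-∀

-- tr((XᵀX)²) = tr((XXᵀ)²) and tr(XᵀX) = tr(XXᵀ), so ‖XᵀX − cI‖² = ‖XXᵀ − cI‖² = 0.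
XXᵀ≐cI⇒XᵀX≐cI : ∀ {n} (X : Matrix n n) c → (X · (X ᵀ)) ≐ (c ∙ₘ I n) → ((X ᵀ) · X) ≐ (c ∙ₘ I n)
XXᵀ≐cI⇒XᵀX≐cI {n} X c XXᵀ≐cI i j =
  i-j≡0⇒i≡j _ _ (‖‖²≡0⇒≐0 (((X ᵀ) · X) -ₘ (c ∙ₘ I n)) ‖XᵀX-cI‖²≡0 i j)
  where
  ‖XᵀX-cI‖²≡0 : ‖ ((X ᵀ) · X) -ₘ (c ∙ₘ I n) ‖² ≡ 0ℤ
  ‖XᵀX-cI‖²≡0 = begin
    ‖ ((X ᵀ) · X) -ₘ (c ∙ₘ I n) ‖²
      ≡⟨ ‖-ₘcI‖² ((X ᵀ) · X) c ⟩
    ‖ (X ᵀ) · X ‖² + (- (+ 2 * c) * tr ((X ᵀ) · X) + (c * c) * tr (I n))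
      ≡⟨ cong₂ (λ u v → u + (- (+ 2 * c) * v + (c * c) * tr (I n))) (‖ᵀ·‖² X) (tr-ᵀ· X) ⟩
    ‖ X · (X ᵀ) ‖² + (- (+ 2 * c) * tr (X · (X ᵀ)) + (c * c) * tr (I n))
      ≡⟨ ‖-ₘcI‖² (X · (X ᵀ)) c ⟨
    ‖ (X · (X ᵀ)) -ₘ (c ∙ₘ I n) ‖²
      ≡⟨ ‖‖²-≐0 _ (λ k l → trans (cong (_- c * I n k l) (XXᵀ≐cI k l)) (+-inverseʳ (c * I n k l))) ⟩
    0ℤ ∎

point : ∀ {m} → Fin m → Fin 2 → Fin (m ℕ.* 2)
point = combine

sign : Fin 2 → Fin 2 → ℤ
sign r t = + 2 * I 2 r t - 1ℤ

GDDGram2-entry : ∀ {m} (x y : Fin (m ℕ.* 2)) →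
  GDDGram2 m 2 (+ m) 0ℤ (+ m) x y
    ≡ + m + sign (remainder {m} 2 x) (remainder {m} 2 y) * (+ m * I m (quotient {m} 2 x) (quotient {m} 2 y))
GDDGram2-entry {m} x y rewrite sym (I⊗I≐I {m} {2} x y) =
  expand (+ m) (I m (quotient {m} 2 x) (quotient {m} 2 y)) (I 2 (remainder {m} 2 x) (remainder {m} 2 y))
  where
  expand : ∀ μ d e → (+ 2 * μ) * (d * e) + ((+ 2 * 0ℤ) * (d * 1ℤ + - (d * e)) + μ * (1ℤ + - (d * 1ℤ)))
                     ≡ μ + (+ 2 * e - 1ℤ) * (μ * d)
  expand = solve-∀

IsSign : ℤ → Set
IsSign h = (h ≡ 1ℤ) ⊎ (h ≡ -1ℤ)

isOne : ℤ → ℤ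
isOne (+ 1) = 1ℤ
isOne _     = 0ℤ

isOne-zeroOne : ∀ h → (isOne h ≡ 0ℤ) ⊎ (isOne h ≡ 1ℤ)
isOne-zeroOne (+ 0)            = inj₁ refl
isOne-zeroOne (+ 1)            = inj₂ refl
isOne-zeroOne (+ suc (suc _)) = inj₁ refl
isOne-zeroOne -[1+ _ ]         = inj₁ refl

-- The 2×2 block replacing an entry h = ±1: I₂ for h = 1 and J₂ − I₂ for h = −1.
block : ℤ → Fin 2 → Fin 2 → ℤ
block h r t = isOne (sign r t * h)

block-sym : ∀ h r t → block h r t ≡ block h t r
block-sym h r t = cong (λ d → isOne ((+ 2 * d - 1ℤ) * h)) (I-sym r t)

block-rowSum : ∀ {h} → IsSign h → ∀ r → Σ (block h r) ≡ 1ℤ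
block-rowSum (inj₁ refl) 0F = refl
block-rowSum (inj₁ refl) 1F = refl
block-rowSum (inj₂ refl) 0F = refl
block-rowSum (inj₂ refl) 1F = refl

block-inner : ∀ {h h′} → IsSign h → IsSign h′ → ∀ r t →
  + 2 * Σ (λ s → block h r s * block h′ t s) ≡ 1ℤ + sign r t * (h * h′)
block-inner (inj₁ refl) (inj₁ refl) 0F 0F = refl
block-inner (inj₁ refl) (inj₁ refl) 0F 1F = refl
block-inner (inj₁ refl) (inj₁ refl) 1F 0F = refl
block-inner (inj₁ refl) (inj₁ refl) 1F 1F = refl
block-inner (inj₁ refl) (inj₂ refl) 0F 0F = refl
block-inner (inj₁ refl) (inj₂ refl) 0F 1F = refl
block-inner (inj₁ refl) (inj₂ refl) 1F 0F = refl
block-inner (inj₁ refl) (inj₂ refl) 1F 1F = refl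
block-inner (inj₂ refl) (inj₁ refl) 0F 0F = refl
block-inner (inj₂ refl) (inj₁ refl) 0F 1F = refl
block-inner (inj₂ refl) (inj₁ refl) 1F 0F = refl
block-inner (inj₂ refl) (inj₁ refl) 1F 1F = refl
block-inner (inj₂ refl) (inj₂ refl) 0F 0F = refl
block-inner (inj₂ refl) (inj₂ refl) 0F 1F = refl
block-inner (inj₂ refl) (inj₂ refl) 1F 0F = refl
block-inner (inj₂ refl) (inj₂ refl) 1F 1F = refl

module _ {m : ℕ} where

  blowUp : Matrix m m → Matrix (m ℕ.* 2) (m ℕ.* 2)
  blowUp H x y = block (H (quotient {m} 2 x) (quotient {m} 2 y)) (remainder {m} 2 x) (remainder {m} 2 y)

  module _ (H : Matrix m m) where

    blowUp-combine : ∀ x j s → blowUp H x (point j s) ≡ block (H (quotient {m} 2 x) j) (remainder {m} 2 x) s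
    blowUp-combine x j s =
      cong₂ (λ k t → block (H (quotient {m} 2 x) k) (remainder {m} 2 x) t) (quotient-combine j s) (remainder-combine j s)

    blowUp-ᵀ : (blowUp H ᵀ) ≐ blowUp (H ᵀ)
    blowUp-ᵀ x y = block-sym _ (remainder {m} 2 y) (remainder {m} 2 x)

    module _ (±H : IsPlusMinusOne H) where

      blowUp-rowSum : ∀ x j → Σ (λ s → blowUp H x (point j s)) ≡ 1ℤ
      blowUp-rowSum x j =
        trans (Σ-cong (blowUp-combine x j)) (block-rowSum (±H (quotient {m} 2 x) j) (remainder {m} 2 x))

      blowUp-gram : (H · (H ᵀ)) ≐ ((+ m) ∙ₘ I m) →
        ((+ 2) ∙ₘ (blowUp H · (blowUp H ᵀ))) ≐ GDDGram2 m 2 (+ m) 0ℤ (+ m)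
      blowUp-gram HHᵀ≐mI x y = begin
        + 2 * Σ (λ z → A x z * A y z)
          ≡⟨ cong (λ u → + 2 * u) (Σ-combine m {2} (λ z → A x z * A y z)) ⟩
        + 2 * Σ {m} (λ j → Σ (λ s → A x (point j s) * A y (point j s)))
          ≡⟨ *-distribˡ-Σ {m} (+ 2) (λ j → Σ (λ s → A x (point j s) * A y (point j s))) ⟩
        Σ {m} (λ j → + 2 * Σ (λ s → A x (point j s) * A y (point j s)))
          ≡⟨ Σ-cong (λ j → cong (λ u → + 2 * u)
               (Σ-cong (λ s → cong₂ _*_ (blowUp-combine x j s) (blowUp-combine y j s)))) ⟩
        Σ (λ j → + 2 * Σ (λ s → block (H qₓ j) rₓ s * block (H q_y j) r_y s))
          ≡⟨ Σ-cong (λ j → block-inner (±H qₓ j) (±H q_y j) rₓ r_y) ⟩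
        Σ (λ j → 1ℤ + sign rₓ r_y * (H qₓ j * H q_y j))
          ≡⟨ Σ-distrib-+ (λ _ → 1ℤ) (λ j → sign rₓ r_y * (H qₓ j * H q_y j)) ⟩
        Σ {m} (λ _ → 1ℤ) + Σ (λ j → sign rₓ r_y * (H qₓ j * H q_y j))
          ≡⟨ cong₂ _+_ (Σ-ones m) (sym (*-distribˡ-Σ (sign rₓ r_y) (λ j → H qₓ j * H q_y j))) ⟩
        + m + sign rₓ r_y * (H · (H ᵀ)) qₓ q_y
          ≡⟨ cong (λ u → + m + sign rₓ r_y * u) (HHᵀ≐mI qₓ q_y) ⟩
        + m + sign rₓ r_y * (+ m * I m qₓ q_y)
          ≡⟨ GDDGram2-entry {m} x y ⟨
        GDDGram2 m 2 (+ m) 0ℤ (+ m) x y ∎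
        where
        A : Matrix (m ℕ.* 2) (m ℕ.* 2)
        A = blowUp H
        qₓ q_y : Fin m
        qₓ = quotient {m} 2 x
        q_y = quotient {m} 2 y
        rₓ r_y : Fin 2
        rₓ = remainder {m} 2 x
        r_y = remainder {m} 2 y

  blowUp-isDesign : (H : Matrix m m) → IsHadamard m H →
    IsSGDDHalf m 2 (+ m) 0ℤ (+ m) (blowUp H)
      × ((blowUp H · (I m ⊗ₘ J 2 2)) ≐ J (m ℕ.* 2) (m ℕ.* 2))
      × (((I m ⊗ₘ J 2 2) · blowUp H) ≐ J (m ℕ.* 2) (m ℕ.* 2))
  blowUp-isDesign H (±H , HHᵀ≐mI) = (zeroOne , blowUp-gram H ±H HHᵀ≐mI , gramᵀ) , rows , cols
    where
    ±Hᵀ : IsPlusMinusOne (H ᵀ)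
    ±Hᵀ i j = ±H j i
    zeroOne : IsZeroOne (blowUp H)
    zeroOne x y = isOne-zeroOne _
    gramᵀ : ((+ 2) ∙ₘ ((blowUp H ᵀ) · blowUp H)) ≐ GDDGram2 m 2 (+ m) 0ℤ (+ m)
    gramᵀ x y = trans (cong (λ u → + 2 * u) (·-cong (blowUp-ᵀ H) (λ i j → blowUp-ᵀ H j i) x y))
      (blowUp-gram (H ᵀ) ±Hᵀ (XXᵀ≐cI⇒XᵀX≐cI H (+ m) HHᵀ≐mI) x y)
    rows : (blowUp H · (I m ⊗ₘ J 2 2)) ≐ J (m ℕ.* 2) (m ℕ.* 2)
    rows x y = trans (·-I⊗J {m} (blowUp H) x y) (blowUp-rowSum H ±H x (quotient {m} 2 y))
    cols : ((I m ⊗ₘ J 2 2) · blowUp H) ≐ J (m ℕ.* 2) (m ℕ.* 2)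
    cols x y = begin
      ((I m ⊗ₘ J 2 2) · blowUp H) x y        ≡⟨ I⊗J-· {m} (blowUp H) x y ⟩
      Σ (λ s → blowUp H (point qₓ s) y)      ≡⟨ Σ-cong (λ s → blowUp-ᵀ H y (point qₓ s)) ⟩
      Σ (λ s → blowUp (H ᵀ) y (point qₓ s))  ≡⟨ blowUp-rowSum (H ᵀ) ±Hᵀ y qₓ ⟩
      1ℤ                                     ∎
      where
      qₓ = quotient {m} 2 x

unit-line-sums : ∀ {a b c d} → a + b ≡ 1ℤ → a + c ≡ 1ℤ → b + d ≡ 1ℤ → c ≡ b × d ≡ a
unit-line-sums {a} {b} {c} {d} a+b≡1 a+c≡1 b+d≡1 =
  ∙-cancelˡ a c b (trans a+c≡1 (sym a+b≡1)) ,
  ∙-cancelˡ b d a (trans b+d≡1 (trans (sym a+b≡1) (+-comm a b)))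

zeroOne-difference : ∀ {a b} → (a ≡ 0ℤ) ⊎ (a ≡ 1ℤ) → (b ≡ 0ℤ) ⊎ (b ≡ 1ℤ) → a + b ≡ 1ℤ → IsSign (a - b)
zeroOne-difference (inj₁ refl) (inj₂ refl) _ = inj₂ refl
zeroOne-difference (inj₂ refl) (inj₁ refl) _ = inj₁ refl
zeroOne-difference (inj₁ refl) (inj₁ refl) ()
zeroOne-difference (inj₂ refl) (inj₂ refl) ()

half-difference : ∀ {P Q} μ d → + 2 * P ≡ μ + 1ℤ * (μ * d) → + 2 * Q ≡ μ + -1ℤ * (μ * d) → P - Q ≡ μ * d
half-difference {P} {Q} μ d 2P≡ 2Q≡ = *-cancelˡ-≡ (+ 2) (P - Q) (μ * d) (begin
  + 2 * (P - Q)                                 ≡⟨ distrib P Q ⟩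
  + 2 * P - + 2 * Q                             ≡⟨ cong₂ _-_ 2P≡ 2Q≡ ⟩
  (μ + 1ℤ * (μ * d)) - (μ + -1ℤ * (μ * d))      ≡⟨ collect μ d ⟩
  + 2 * (μ * d)                                 ∎)
  where
  distrib : ∀ P Q → + 2 * (P - Q) ≡ + 2 * P - + 2 * Q
  distrib = solve-∀
  collect : ∀ μ d → (μ + 1ℤ * (μ * d)) - (μ + -1ℤ * (μ * d)) ≡ + 2 * (μ * d)
  collect = solve-∀

module _ {m : ℕ} (A : Matrix (m ℕ.* 2) (m ℕ.* 2)) where

  blockSign : Matrix m m
  blockSign i j = A (point i 0F) (point j 0F) - A (point i 0F) (point j 1F)

  module _ (rows : (A · (I m ⊗ₘ J 2 2)) ≐ J (m ℕ.* 2) (m ℕ.* 2))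
           (cols : ((I m ⊗ₘ J 2 2) · A) ≐ J (m ℕ.* 2) (m ℕ.* 2)) where

    row-pair : ∀ x (j : Fin m) → A x (point j 0F) + A x (point j 1F) ≡ 1ℤ
    row-pair x j = begin
      A x (point j 0F) + A x (point j 1F)
        ≡⟨ Σ-Fin2 (λ s → A x (point j s)) ⟨
      Σ (λ s → A x (point j s))
        ≡⟨ cong (λ k → Σ (λ s → A x (point k s))) (quotient-combine j 0F) ⟨
      Σ (λ s → A x (point (quotient {m} 2 (point j 0F)) s))
        ≡⟨ ·-I⊗J {m} A x (point j 0F) ⟨
      (A · (I m ⊗ₘ J 2 2)) x (point j 0F)
        ≡⟨ rows x (point j 0F) ⟩
      1ℤ ∎

    col-pair : ∀ (i : Fin m) y → A (point i 0F) y + A (point i 1F) y ≡ 1ℤ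
    col-pair i y = begin
      A (point i 0F) y + A (point i 1F) y
        ≡⟨ Σ-Fin2 (λ s → A (point i s) y) ⟨
      Σ (λ s → A (point i s) y)
        ≡⟨ cong (λ k → Σ (λ s → A (point k s) y)) (quotient-combine i 0F) ⟨
      Σ (λ s → A (point (quotient {m} 2 (point i 0F)) s) y)
        ≡⟨ I⊗J-· {m} A (point i 0F) y ⟨
      ((I m ⊗ₘ J 2 2) · A) (point i 0F) y
        ≡⟨ cols (point i 0F) y ⟩
      1ℤ ∎

    blockSign-isHadamard : IsZeroOne A → ((+ 2) ∙ₘ (A · (A ᵀ))) ≐ GDDGram2 m 2 (+ m) 0ℤ (+ m) →
      IsHadamard m (blockSign)
    blockSign-isHadamard zeroOne 2AAᵀ≐G = ±1 , gram
      where
      ±1 : IsPlusMinusOne (blockSign)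
      ±1 i j = zeroOne-difference (zeroOne _ _) (zeroOne _ _) (row-pair (point i 0F) j)

      gram : (blockSign · (blockSign ᵀ)) ≐ ((+ m) ∙ₘ I m)
      gram i k = begin
        Σ (λ j → blockSign i j * blockSign k j)
          ≡⟨ Σ-cong inner-block ⟩
        Σ (λ j → f j - g j)
          ≡⟨ Σ-distrib-- f g ⟩
        Σ f - Σ g
          ≡⟨ cong₂ _-_ (Σ-pairs m (λ z → A xᵢ z * A (point k 0F) z)) (Σ-pairs m (λ z → A xᵢ z * A (point k 1F) z)) ⟨
        (A · (A ᵀ)) xᵢ (point k 0F) - (A · (A ᵀ)) xᵢ (point k 1F)
          ≡⟨ half-difference (+ m) (I m i k) (gram-at 0F) (gram-at 1F) ⟩
        + m * I m i k ∎
        where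
        xᵢ : Fin (m ℕ.* 2)
        xᵢ = point i 0F
        f g : Fin m → ℤ
        f j = A xᵢ (point j 0F) * A (point k 0F) (point j 0F) + A xᵢ (point j 1F) * A (point k 0F) (point j 1F)
        g j = A xᵢ (point j 0F) * A (point k 1F) (point j 0F) + A xᵢ (point j 1F) * A (point k 1F) (point j 1F)

        inner-block : ∀ j → blockSign i j * blockSign k j ≡ f j - g j
        inner-block j =
          let c≡b , d≡a = unit-line-sums (row-pair (point k 0F) j) (col-pair k (point j 0F)) (col-pair k (point j 1F))
          in trans (difference-product a a′ b b′) (cong (λ u → (a * b + a′ * b′) - u) (sym (cong₂ (λ u v → a * u + a′ * v) c≡b d≡a)))
          where
          a a′ b b′ : ℤ
          a = A xᵢ (point j 0F)
          a′ = A xᵢ (point j 1F)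
          b = A (point k 0F) (point j 0F)
          b′ = A (point k 0F) (point j 1F)
          difference-product : ∀ a a′ b b′ → (a - a′) * (b - b′) ≡ (a * b + a′ * b′) - (a * b′ + a′ * b)
          difference-product = solve-∀

        gram-at : ∀ t → + 2 * (A · (A ᵀ)) xᵢ (point k t) ≡ + m + sign 0F t * (+ m * I m i k)
        gram-at t = begin
          + 2 * (A · (A ᵀ)) xᵢ (point k t)
            ≡⟨ 2AAᵀ≐G xᵢ (point k t) ⟩
          GDDGram2 m 2 (+ m) 0ℤ (+ m) xᵢ (point k t)
            ≡⟨ GDDGram2-entry {m} xᵢ (point k t) ⟩
          + m + sign (remainder {m} 2 xᵢ) (remainder {m} 2 (point k t))
                * (+ m * I m (quotient {m} 2 xᵢ) (quotient {m} 2 (point k t)))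
            ≡⟨ cong₂ (λ u v → + m + u * (+ m * v))
                 (cong₂ sign (remainder-combine i 0F) (remainder-combine k t))
                 (cong₂ (I m) (quotient-combine i 0F) (quotient-combine k t)) ⟩
          + m + sign 0F t * (+ m * I m i k) ∎

lemma5p3 : (m : ℕ) → 2 ℕ.≤ m →
    (Σ[ A ∈ Matrix (m ℕ.* 2) (m ℕ.* 2) ]
        (IsSGDDHalf m 2 (+ m) 0ℤ (+ m) A
         × ((A · (I m ⊗ₘ J 2 2)) ≐ J (m ℕ.* 2) (m ℕ.* 2))
         × (((I m ⊗ₘ J 2 2) · A) ≐ J (m ℕ.* 2) (m ℕ.* 2))))
    ⇔ (Σ[ H ∈ Matrix m m ] IsHadamard m H)
lemma5p3 m _ = mk⇔
  (λ { (A , (zeroOne , 2AAᵀ≐G , _) , rows , cols) →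
         blockSign A , blockSign-isHadamard A rows cols zeroOne 2AAᵀ≐G })
  (λ { (H , isHadamard) → blowUp H , blowUp-isDesign H isHadamard })
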